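{- Let $F\colon[0,m+1]\to\mathbb{R}$ be a piecewise linear map determined by its values at the integers, where these values are distinct except that $F(j)=F(q)$ for two maxima $j\neq q$ of $F$. Let $f,g\colon[0,m+1]\to\mathbb{R}$ be the piecewise linear maps with the same integer values as $F$ except $f(j)=F(j)-\varepsilon$ and $g(j)=F(j)+\varepsilon$, for sufficiently small $\varepsilon>0$. If the straight-line homotopy from $-f$ to $-g$ (an interchange of the minima $j,q$ of $-f$) is relevant, then so is the straight-line homotopy from $f$ to $g$ (an interchange of the maxima $j,q$ of $f$).
   Context: Banana tree $\mathcal U(\varphi)$ of a generic piecewise linear map $\varphi$ (distinct values at integers; critical points = local minima and maxima): take the unique full binary tree on the critical points whose in-order is the order of positions and in which values increase towards the root; add a special root above the root, greater than all items in value and position; decompose the edges into paths joining each leaf $a$ to its nearest ancestor $b$ for which $a$ is not the minimum-value node in the subtree of $b$ (or to the special root); split each path into a left trail ($a$, $b$, path nodes whose right child is on the path) and a right trail ($a$, $b$, path nodes whose left child is on the path), forming the banana spanned by the pair $a,b$ (the pairing). The up-tree is $\mathcal U(f)$ and the down-tree is $\mathcal D(f)=\mathcal U(-f)$. The interchange of maxima from $f$ to $g$ is relevant if $\mathcal U(f)$ and $\mathcal U(g)$ differ by a rotation of $j$ and $q$ (in the underlying binary tree). The interchange of minima from $-f$ to $-g$ is relevant if $\mathcal D(f)$ and $\mathcal D(g)$ differ by a change in the pairing.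
   Formalization: The integer values of $F$ and the perturbation $\varepsilon$ are taken in ℚ rather than ℝ. -}

module Defs where

open import Data.Nat using (ℕ; zero; suc; _∸_; _≡ᵇ_)
open import Data.Bool using (Bool; true; false; _∧_; _∨_; not; if_then_else_)
open import Data.List using (List; []; _∷_; _++_; [_]; map; foldl; filterᵇ; upTo)
open import Data.Maybe using (Maybe; just; nothing)
open import Data.Product using (_×_; _,_)
open import Data.Sum using (_⊎_)
open import Data.Rational using (ℚ; _<_; _+_; -_)
open import Data.Rational.Properties using (_<?_)
open import Relation.Nullary using (does; ¬_)
open import Relation.Binary.PropositionalEquality using (_≡_)

-- A piecewise linear map on [0, m+1] is determined by its values at the
-- integers 0,…,m+1; we represent it by φ : ℕ → ℚ (only the values at
-- 0,…,m+1 are ever used).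

_<ᵇ_ : ℚ → ℚ → Bool
x <ᵇ y = does (x <? y)

neg : (ℕ → ℚ) → (ℕ → ℚ)
neg φ i = - φ i

perturb : (ℕ → ℚ) → ℕ → ℚ → (ℕ → ℚ)
perturb φ j δ i = if i ≡ᵇ j then φ j + δ else φ i

isMinᵇ : (ℕ → ℚ) → ℕ → ℕ → Bool
isMinᵇ φ m i = ((i ≡ᵇ 0) ∨ (φ i <ᵇ φ (i ∸ 1))) ∧ ((i ≡ᵇ suc m) ∨ (φ i <ᵇ φ (suc i)))

isMaxᵇ : (ℕ → ℚ) → ℕ → ℕ → Bool
isMaxᵇ φ m i = ((i ≡ᵇ 0) ∨ (φ (i ∸ 1) <ᵇ φ i)) ∧ ((i ≡ᵇ suc m) ∨ (φ (suc i) <ᵇ φ i))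

IsMax : (ℕ → ℚ) → ℕ → ℕ → Set
IsMax φ m i = ((i ≡ 0) ⊎ (φ (i ∸ 1) < φ i)) × ((i ≡ suc m) ⊎ (φ (suc i) < φ i))

crits : (ℕ → ℚ) → ℕ → List ℕ
crits φ m = filterᵇ (λ i → isMinᵇ φ m i ∨ isMaxᵇ φ m i) (upTo (suc (suc m)))

data BT : Set where
  empty : BT
  node  : BT → ℕ → BT → BT

-- Insertion at the right end of a max-heap-ordered binary tree whose
-- in-order is the position order (Cartesian tree construction).
insertR : (ℕ → ℚ) → ℕ → BT → BT
insertR φ x empty        = node empty x empty
insertR φ x (node l y r) =
  if φ x <ᵇ φ y then node l y (insertR φ x r) else node (node l y r) x empty

-- The underlying binary tree of the up-tree 𝒰(φ): the unique binary tree
-- on the critical points whose in-order is the position order and whose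
-- values increase towards the root.
upTree : (ℕ → ℚ) → ℕ → BT
upTree φ m = foldl (λ t x → insertR φ x t) empty (crits φ m)

-- underlying binary tree of the down-tree 𝒟(φ) = 𝒰(-φ)
downTree : (ℕ → ℚ) → ℕ → BT
downTree φ m = upTree (neg φ) m

memᵇ : ℕ → BT → Bool
memᵇ a empty        = false
memᵇ a (node l x r) = (a ≡ᵇ x) ∨ (memᵇ a l ∨ memᵇ a r)

leaves : BT → List ℕ
leaves empty                = []
leaves (node empty x empty) = [ x ]
leaves (node l x r)         = leaves l ++ leaves r

minNode : (ℕ → ℚ) → BT → Maybe ℕ
minNode φ empty = nothing
minNode φ (node l x r) = pick (pick (just x) (minNode φ l)) (minNode φ r)
  where
  pick : Maybe ℕ → Maybe ℕ → Maybe ℕ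
  pick nothing  b        = b
  pick a        nothing  = a
  pick (just a) (just b) = if φ b <ᵇ φ a then just b else just a

ancestors : ℕ → BT → List BT
ancestors a empty = []
ancestors a (node l x r) =
  if memᵇ a l then ancestors a l ++ [ node l x r ]
  else if memᵇ a r then ancestors a r ++ [ node l x r ] else []

rootLabel : BT → Maybe ℕ
rootLabel empty        = nothing
rootLabel (node _ x _) = just x

isJustEq : ℕ → Maybe ℕ → Bool
isJustEq a (just b) = a ≡ᵇ b
isJustEq a nothing  = false

-- nearest ancestor b of leaf a such that a is not the minimum-value node
-- of the subtree of b; nothing = the special root
partner : (ℕ → ℚ) → ℕ → List BT → Maybe ℕ
partner φ a []       = nothing
partner φ a (t ∷ ts) = if isJustEq a (minNode φ t) then partner φ a ts else rootLabel t

pairing : (ℕ → ℚ) → BT → List (ℕ × Maybe ℕ)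
pairing φ t = map (λ a → (a , partner φ a (ancestors a t))) (leaves t)

SamePair : ℕ → ℕ → ℕ → ℕ → Set
SamePair a b x y = ((x ≡ a) × (y ≡ b)) ⊎ ((x ≡ b) × (y ≡ a))

data Rot (a b : ℕ) : BT → BT → Set where
  rotR : ∀ A B C x y → SamePair a b x y →
         Rot a b (node (node A x B) y C) (node A x (node B y C))
  rotL : ∀ A B C x y → SamePair a b x y →
         Rot a b (node A x (node B y C)) (node (node A x B) y C)
  inL  : ∀ {l l'} x r → Rot a b l l' → Rot a b (node l x r) (node l' x r)
  inR  : ∀ {r r'} l x → Rot a b r r' → Rot a b (node l x r) (node l x r')

-- interchange of maxima j, q from f to g is relevant:
-- 𝒰(f) and 𝒰(g) differ by a rotation of j and q
RelevantMaxInterchange : ℕ → (ℕ → ℚ) → (ℕ → ℚ) → ℕ → ℕ → Set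
RelevantMaxInterchange m f g j q = Rot j q (upTree f m) (upTree g m)

-- interchange of minima from -f to -g is relevant:
-- 𝒟(f) and 𝒟(g) differ by a change in the pairing
RelevantMinInterchange : ℕ → (ℕ → ℚ) → (ℕ → ℚ) → Set
RelevantMinInterchange m f g =
  ¬ (pairing (neg f) (downTree f m) ≡ pairing (neg g) (downTree g m))

-- Let a < b be j and q in position order and let ε₀ be smaller than every gap |F y − F j|.
-- Then f and g compare any two positions as F does, except the pair a, b, whose order
-- differs between f and g; in particular f, g and F have the same critical points, and
-- between the maxima a and b lies a minimum c, the argmin of F on [a, b].
-- Trees are built by inserting the critical points from left to right along the right spine.
-- If every critical point strictly between a and b is below F j, the up-trees of f and g
-- agree until b is inserted, which lands below a for one map and above a for the other:
-- the trees differ by the rotation of a and b.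
-- Otherwise some critical point k between a and b lies above F j. In the down-trees, c is
-- inserted after a and pushes it off the right spine, so a and b are never compared and
-- D(f) = D(g); every subtree containing both a and b contains k, which beats both, so all
-- minimum nodes, hence the pairings, coincide and the interchange of minima is irrelevant.

module Submission where

open import Defs
open import Data.Bool using (Bool; true; false; T; T?; _∨_; _∧_; if_then_else_)
open import Data.Bool.Properties using (∨-zeroʳ; ∨-comm; not-¬)
open import Data.Empty using (⊥-elim)
open import Data.List using (List; []; _∷_; _++_; [_]; foldl; filterᵇ; upTo)
open import Data.List.Properties using (++-assoc; ++-identityʳ; foldl-++; map-cong)
open import Data.List.Membership.Propositional using (_∈_; find)
open import Data.List.Membership.Propositional.Properties
  using (∈-++⁻; ∈-++⁺ˡ; ∈-++⁺ʳ; ∈-∃++; ∈-filter⁺; ∈-filter⁻; ∈-upTo⁺; ∈-upTo⁻)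
open import Data.List.Relation.Unary.All as All using (All)
import Data.List.Relation.Unary.All.Properties as AllP
open import Data.List.Relation.Unary.AllPairs as AllPairs using (AllPairs; _∷_)
import Data.List.Relation.Unary.AllPairs.Properties as AllPairsP
open import Data.List.Relation.Unary.Any using (here; there)
open import Data.Maybe using (Maybe; just; nothing)
open import Data.Nat using (ℕ; zero; suc; _≤_; _∸_; _≡ᵇ_; s≤s) renaming (_<_ to _<ₙ_)
import Data.Nat.Properties as ℕ
open import Data.Product using (_×_; _,_; ∃-syntax; proj₁; proj₂)
open import Data.Rational using (ℚ; _<_; _+_; _-_; -_; _⊓_; 0ℚ; 1ℚ)
open import Data.Rational.Properties using (_<?_)
import Data.Rational.Properties as ℚ
open import Data.Sum using (_⊎_; inj₁; inj₂; [_,_]′; map₂)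
open import Data.Unit using (tt)
open import Function using (_∘_; id)
open import Function.Bundles using (mk⇔)
open import Relation.Binary.Definitions using (Tri; tri<; tri≈; tri>)
open import Relation.Binary.PropositionalEquality using (_≡_; _≢_; refl; sym; trans; cong; cong₂; subst; subst₂; module ≡-Reasoning)
open import Relation.Nullary using (¬_; Dec; does; yes; no)
open import Relation.Nullary.Decidable using (dec-true; dec-false; does-⇔; _×-dec_; _⊎-dec_)

<⇒<ᵇ : ∀ {x y} → x < y → (x <ᵇ y) ≡ true
<⇒<ᵇ {x} {y} = dec-true (x <? y)

≮⇒<ᵇ≡false : ∀ {x y} → ¬ x < y → (x <ᵇ y) ≡ false
≮⇒<ᵇ≡false {x} {y} = dec-false (x <? y)

<ᵇ⇒< : ∀ {x y} → (x <ᵇ y) ≡ true → x < y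
<ᵇ⇒< {x} {y} = go (x <? y)
  where
  go : (d : Dec (x < y)) → does d ≡ true → x < y
  go (yes x<y) _ = x<y

<ᵇ≡false⇒≮ : ∀ {x y} → (x <ᵇ y) ≡ false → ¬ x < y
<ᵇ≡false⇒≮ {x} {y} = go (x <? y)
  where
  go : (d : Dec (x < y)) → does d ≡ false → ¬ x < y
  go (no x≮y) _ = x≮y

<ᵇ-irrefl : ∀ x → (x <ᵇ x) ≡ false
<ᵇ-irrefl x = ≮⇒<ᵇ≡false {x} {x} (ℚ.<-irrefl refl)

neg-cancel-< : ∀ {x y} → - x < - y → y < x
neg-cancel-< {x} {y} -x<-y with ℚ.<-cmp y x
... | tri< y<x _ _ = y<x
... | tri≈ _ refl _ = ⊥-elim (ℚ.<-irrefl refl -x<-y)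
... | tri> _ _ x<y = ⊥-elim (ℚ.<-asym -x<-y (ℚ.neg-antimono-< x<y))

neg-<ᵇ : ∀ x y → ((- x) <ᵇ (- y)) ≡ (y <ᵇ x)
neg-<ᵇ x y = does-⇔ (mk⇔ neg-cancel-< ℚ.neg-antimono-<) (- x <? - y) (y <? x)

-- Cartesian trees built along the right spine

insertAll : (ℕ → ℚ) → BT → List ℕ → BT
insertAll φ = foldl (λ t x → insertR φ x t)

insertAll-++ : ∀ φ t xs ys → insertAll φ t (xs ++ ys) ≡ insertAll φ (insertAll φ t xs) ys
insertAll-++ φ = foldl-++ (λ t x → insertR φ x t)

inorder : BT → List ℕ
inorder empty        = []
inorder (node l x r) = inorder l ++ x ∷ inorder r

spine : BT → List ℕ
spine empty        = []
spine (node l x r) = x ∷ spine r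

∈-root : ∀ l x r → x ∈ inorder (node l x r)
∈-root l x r = ∈-++⁺ʳ (inorder l) (here refl)

∈-left : ∀ {y} l x r → y ∈ inorder l → y ∈ inorder (node l x r)
∈-left l x r = ∈-++⁺ˡ

∈-right : ∀ {y} l x r → y ∈ inorder r → y ∈ inorder (node l x r)
∈-right l x r p = ∈-++⁺ʳ (inorder l) (there p)

spine⊆inorder : ∀ t {y} → y ∈ spine t → y ∈ inorder t
spine⊆inorder (node l x r) (here refl) = ∈-root l x r
spine⊆inorder (node l x r) (there p)   = ∈-right l x r (spine⊆inorder r p)

inorder-insertR : ∀ φ x t → inorder (insertR φ x t) ≡ inorder t ++ [ x ]
inorder-insertR φ x empty = refl
inorder-insertR φ x (node l y r) with φ x <ᵇ φ y
... | true  = trans (cong (λ s → inorder l ++ y ∷ s) (inorder-insertR φ x r))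
                    (sym (++-assoc (inorder l) (y ∷ inorder r) [ x ]))
... | false = refl

inorder-insertAll : ∀ φ t xs → inorder (insertAll φ t xs) ≡ inorder t ++ xs
inorder-insertAll φ t []       = sym (++-identityʳ (inorder t))
inorder-insertAll φ t (x ∷ xs) =
  trans (inorder-insertAll φ (insertR φ x t) xs)
        (trans (cong (_++ xs) (inorder-insertR φ x t)) (++-assoc (inorder t) [ x ] xs))

∈-inorder-insertR : ∀ φ x t xs {y} → y ∈ inorder (insertR φ x t) ++ xs → y ∈ inorder t ++ x ∷ xs
∈-inorder-insertR φ x t xs =
  subst (_ ∈_) (trans (cong (_++ xs) (inorder-insertR φ x t)) (++-assoc (inorder t) [ x ] xs))

spine-insertR : ∀ φ x t {y} → y ∈ spine (insertR φ x t) →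
  y ≡ x ⊎ (y ∈ spine t × (φ x <ᵇ φ y) ≡ true)
spine-insertR φ x empty (here refl) = inj₁ refl
spine-insertR φ x (node l z r) p with φ x <ᵇ φ z in x<z
spine-insertR φ x (node l z r) (here refl) | true  = inj₂ (here refl , x<z)
spine-insertR φ x (node l z r) (there p)   | true  with spine-insertR φ x r p
... | inj₁ y≡x          = inj₁ y≡x
... | inj₂ (y∈r , x<y) = inj₂ (there y∈r , x<y)
spine-insertR φ x (node l z r) (here refl) | false = inj₁ refl

spine-insertAll : ∀ φ t xs {y} → y ∈ spine (insertAll φ t xs) → y ∈ xs ⊎ y ∈ spine t
spine-insertAll φ t []       p = inj₂ p
spine-insertAll φ t (x ∷ xs) p with spine-insertAll φ (insertR φ x t) xs p
... | inj₁ y∈xs = inj₁ (there y∈xs)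
... | inj₂ y∈s with spine-insertR φ x t y∈s
...   | inj₁ refl     = inj₁ (here refl)
...   | inj₂ (y∈t , _) = inj₂ y∈t

spine-insertAll-empty : ∀ φ xs {y} → y ∈ spine (insertAll φ empty xs) → y ∈ xs
spine-insertAll-empty φ xs p with spine-insertAll φ empty xs p
... | inj₁ q = q

-- Once c has been inserted above a, a is off the right spine for good.
spine-after-pivot : ∀ φ t a c xs ys {y} → (φ c <ᵇ φ a) ≡ false →
  y ∈ spine (insertAll φ (insertR φ c (insertAll φ (insertR φ a t) xs)) ys) →
  y ∈ ys ⊎ y ≡ c ⊎ y ∈ xs ⊎ y ∈ spine t
spine-after-pivot φ t a c xs ys c≮a p with spine-insertAll φ _ ys p
... | inj₁ q = inj₁ q
... | inj₂ q with spine-insertR φ c _ q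
...   | inj₁ y≡c = inj₂ (inj₁ y≡c)
...   | inj₂ (q′ , c<y) with spine-insertAll φ _ xs q′
...     | inj₁ r = inj₂ (inj₂ (inj₁ r))
...     | inj₂ r with spine-insertR φ a t r
...       | inj₁ refl    = ⊥-elim (not-¬ c<y c≮a)
...       | inj₂ (r′ , _) = inj₂ (inj₂ (inj₂ r′))

insertR-cong : ∀ φ ψ x t → (∀ y → y ∈ spine t → (φ x <ᵇ φ y) ≡ (ψ x <ᵇ ψ y)) →
  insertR φ x t ≡ insertR ψ x t
insertR-cong φ ψ x empty        agree = refl
insertR-cong φ ψ x (node l z r) agree rewrite agree z (here refl) with ψ x <ᵇ ψ z
... | true  = cong (node l z) (insertR-cong φ ψ x r (λ y p → agree y (there p)))
... | false = refl

insertAll-cong : ∀ φ ψ t xs → (∀ x y → x ∈ xs → y ∈ inorder t ++ xs → (φ x <ᵇ φ y) ≡ (ψ x <ᵇ ψ y)) →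
  insertAll φ t xs ≡ insertAll ψ t xs
insertAll-cong φ ψ t []       agree = refl
insertAll-cong φ ψ t (x ∷ xs) agree
  rewrite insertR-cong φ ψ x t (λ y p → agree x y (here refl) (∈-++⁺ˡ (spine⊆inorder t p))) =
  insertAll-cong φ ψ (insertR ψ x t) xs
    (λ x' y p q → agree x' y (there p) (∈-inorder-insertR ψ x t xs q))

insertR-above : ∀ φ x t → (∀ y → y ∈ spine t → (φ x <ᵇ φ y) ≡ false) → insertR φ x t ≡ node t x empty
insertR-above φ x empty        above = refl
insertR-above φ x (node l y r) above rewrite above y (here refl) = refl

data Ctx : Set where
  hole  : Ctx
  right : BT → ℕ → Ctx → Ctx

plug : Ctx → BT → BT
plug hole          X = X
plug (right l y C) X = node l y (plug C X)

labels : Ctx → List ℕ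
labels hole          = []
labels (right l y C) = y ∷ labels C

insertR-split : ∀ φ x t → ∃[ C ] ∃[ A ] (insertR φ x t ≡ plug C (node A x empty) ×
  (∀ y → y ∈ labels C → (φ x <ᵇ φ y) ≡ true × y ∈ spine t))
insertR-split φ x empty = hole , empty , refl , λ y ()
insertR-split φ x (node l z r) with φ x <ᵇ φ z in x<z
... | false = hole , node l z r , refl , λ y ()
... | true with insertR-split φ x r
...   | C , A , eq , below = right l z C , A , cong (node l z) eq , below′
  where
  below′ : ∀ y → y ∈ labels (right l z C) → (φ x <ᵇ φ y) ≡ true × y ∈ spine (node l z r)
  below′ y (here refl) = x<z , here refl
  below′ y (there p)   = proj₁ (below y p) , there (proj₂ (below y p))

insertR-plug : ∀ φ x C X → (∀ y → y ∈ labels C → (φ x <ᵇ φ y) ≡ true) →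
  insertR φ x (plug C X) ≡ plug C (insertR φ x X)
insertR-plug φ x hole          X below = refl
insertR-plug φ x (right l y C) X below rewrite below y (here refl) =
  cong (node l y) (insertR-plug φ x C X (λ z p → below z (there p)))

insertAll-plug : ∀ φ C A a B xs →
  (∀ x → x ∈ xs → (∀ y → y ∈ labels C → (φ x <ᵇ φ y) ≡ true) × (φ x <ᵇ φ a) ≡ true) →
  insertAll φ (plug C (node A a B)) xs ≡ plug C (node A a (insertAll φ B xs))
insertAll-plug φ C A a B []       below = refl
insertAll-plug φ C A a B (x ∷ xs) below
  rewrite insertR-plug φ x C (node A a B) (proj₁ (below x (here refl)))
        | proj₂ (below x (here refl)) =
  insertAll-plug φ C A a (insertR φ x B) xs (λ x' p → below x' (there p))

rot-plug : ∀ {a b X Y} C → Rot a b X Y → Rot a b (plug C X) (plug C Y)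
rot-plug hole          r = r
rot-plug (right l y C) r = inR l y (rot-plug C r)

Rot-relabel : ∀ {a b a' b' t t'} → (∀ {x y} → SamePair a b x y → SamePair a' b' x y) →
  Rot a b t t' → Rot a' b' t t'
Rot-relabel f (rotR A B C x y p) = rotR A B C x y (f p)
Rot-relabel f (rotL A B C x y p) = rotL A B C x y (f p)
Rot-relabel f (inL x r rot)      = inL x r (Rot-relabel f rot)
Rot-relabel f (inR l x rot)      = inR l x (Rot-relabel f rot)

first∈pair : ∀ {a b x y} → SamePair a b x y → x ≡ a ⊎ x ≡ b
first∈pair (inj₁ (x≡a , _)) = inj₁ x≡a
first∈pair (inj₂ (x≡b , _)) = inj₂ x≡b

second∈pair : ∀ {a b x y} → SamePair a b x y → y ≡ a ⊎ y ≡ b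
second∈pair (inj₁ (_ , y≡b)) = inj₂ y≡b
second∈pair (inj₂ (_ , y≡a)) = inj₁ y≡a

module _ (φ ψ : ℕ → ℚ) (a b : ℕ) where

  ComparesAlike : ℕ → Set
  ComparesAlike x = ∃[ c ] (∀ u → u ≡ a ⊎ u ≡ b → (φ x <ᵇ φ u) ≡ c × (ψ x <ᵇ ψ u) ≡ c)

  rot-insertR : ∀ x {t t'} → (∀ y → y ∈ inorder t → (φ x <ᵇ φ y) ≡ (ψ x <ᵇ ψ y)) → ComparesAlike x →
    Rot a b t t' → Rot a b (insertR φ x t) (insertR ψ x t')
  rot-insertR x agree (false , alike) (rotR A B C u v p)
    rewrite proj₁ (alike v (second∈pair p)) | proj₂ (alike u (first∈pair p)) =
    inL x empty (rotR A B C u v p)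
  rot-insertR x agree (true , alike) (rotR A B C u v p)
    rewrite proj₁ (alike v (second∈pair p)) | proj₂ (alike u (first∈pair p))
          | proj₂ (alike v (second∈pair p))
          | insertR-cong φ ψ x C (λ y q → agree y (∈-right (node A u B) v C (spine⊆inorder C q))) =
    rotR A B (insertR ψ x C) u v p
  rot-insertR x agree (false , alike) (rotL A B C u v p)
    rewrite proj₁ (alike u (first∈pair p)) | proj₂ (alike v (second∈pair p)) =
    inL x empty (rotL A B C u v p)
  rot-insertR x agree (true , alike) (rotL A B C u v p)
    rewrite proj₁ (alike u (first∈pair p)) | proj₁ (alike v (second∈pair p))
          | proj₂ (alike v (second∈pair p))
          | insertR-cong φ ψ x C (λ y q → agree y (∈-right A u (node B v C) (∈-right B v C (spine⊆inorder C q)))) =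
    rotL A B (insertR ψ x C) u v p
  rot-insertR x agree alike (inL {l} z r rot) rewrite agree z (∈-root l z r) with ψ x <ᵇ ψ z
  ... | false = inL x empty (inL z r rot)
  ... | true rewrite insertR-cong φ ψ x r (λ y q → agree y (∈-right l z r (spine⊆inorder r q))) =
    inL z (insertR ψ x r) rot
  rot-insertR x agree alike (inR {r} l z rot) rewrite agree z (∈-root l z r) with ψ x <ᵇ ψ z
  ... | false = inL x empty (inR l z rot)
  ... | true  = inR l z (rot-insertR x (λ y q → agree y (∈-right l z r q)) alike rot)

  rot-insertAll : ∀ xs {X Y} →
    (∀ x → x ∈ xs → (∀ y → y ∈ inorder X ++ xs → (φ x <ᵇ φ y) ≡ (ψ x <ᵇ ψ y)) × ComparesAlike x) →
    Rot a b X Y → Rot a b (insertAll φ X xs) (insertAll ψ Y xs)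
  rot-insertAll []       h rot = rot
  rot-insertAll (x ∷ xs) {X} h rot =
    rot-insertAll xs (λ x' p → (λ y q → proj₁ (h x' (there p)) y (∈-inorder-insertR φ x X xs q)) ,
                               proj₂ (h x' (there p)))
      (rot-insertR x (λ y q → proj₁ (h x (here refl)) y (∈-++⁺ˡ q)) (proj₂ (h x (here refl))) rot)

  insertR-flip : ∀ A B → (∀ y → y ∈ spine B → (φ b <ᵇ φ y) ≡ false × (ψ b <ᵇ ψ y) ≡ false) →
    (φ b <ᵇ φ a) ≢ (ψ b <ᵇ ψ a) → Rot a b (insertR φ b (node A a B)) (insertR ψ b (node A a B))
  insertR-flip A B above flips with φ b <ᵇ φ a | ψ b <ᵇ ψ a
  ... | true  | true  = ⊥-elim (flips refl)
  ... | false | false = ⊥-elim (flips refl)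
  ... | true  | false rewrite insertR-above φ b B (λ y p → proj₁ (above y p)) =
    rotL A B empty a b (inj₁ (refl , refl))
  ... | false | true  rewrite insertR-above ψ b B (λ y p → proj₂ (above y p)) =
    rotR A B empty a b (inj₁ (refl , refl))

  insertR-flip-plug : ∀ C A B → (∀ y → y ∈ labels C → (φ b <ᵇ φ y) ≡ true × (ψ b <ᵇ ψ y) ≡ true) →
    (∀ y → y ∈ spine B → (φ b <ᵇ φ y) ≡ false × (ψ b <ᵇ ψ y) ≡ false) → (φ b <ᵇ φ a) ≢ (ψ b <ᵇ ψ a) →
    Rot a b (insertR φ b (plug C (node A a B))) (insertR ψ b (plug C (node A a B)))
  insertR-flip-plug C A B below above flips = subst₂ (Rot a b)
    (sym (insertR-plug φ b C (node A a B) (λ y p → proj₁ (below y p))))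
    (sym (insertR-plug ψ b C (node A a B) (λ y p → proj₂ (below y p))))
    (rot-plug C (insertR-flip A B above flips))

-- Changing the comparison of a single pair

insertAll-around : ∀ χ t pre a mid b post →
  insertAll χ t (pre ++ a ∷ mid ++ b ∷ post) ≡
  insertAll χ (insertR χ b (insertAll χ (insertR χ a (insertAll χ t pre)) mid)) post
insertAll-around χ t pre a mid b post =
  trans (insertAll-++ χ t pre (a ∷ mid ++ b ∷ post))
        (insertAll-++ χ (insertR χ a (insertAll χ t pre)) mid (b ∷ post))

InRange : ℕ → BT → Set
InRange n t = ∀ y → y ∈ inorder t → y ≤ n

inRange-insertR : ∀ {n} φ x t → InRange n t → x ≤ n → InRange n (insertR φ x t)
inRange-insertR φ x t t≤n x≤n y p with ∈-++⁻ (inorder t) (subst (y ∈_) (inorder-insertR φ x t) p)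
... | inj₁ q         = t≤n y q
... | inj₂ (here refl) = x≤n

inRange-insertAll : ∀ {n} φ t xs → InRange n t → All (_≤ n) xs → InRange n (insertAll φ t xs)
inRange-insertAll φ t xs t≤n xs≤n y p with ∈-++⁻ (inorder t) (subst (y ∈_) (inorder-insertAll φ t xs) p)
... | inj₁ q = t≤n y q
... | inj₂ q = All.lookup xs≤n q

insertAll-cong-∷ : ∀ φ ψ x t xs → insertR φ x t ≡ insertR ψ x t →
  insertAll φ (insertR φ x t) xs ≡ insertAll ψ (insertR φ x t) xs →
  insertAll φ t (x ∷ xs) ≡ insertAll ψ t (x ∷ xs)
insertAll-cong-∷ φ ψ x t xs head tail = trans tail (cong (λ s → insertAll ψ s xs) head)

insertAll-cong-++ : ∀ φ ψ t xs ys → insertAll φ t xs ≡ insertAll ψ t xs →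
  insertAll φ (insertAll φ t xs) ys ≡ insertAll ψ (insertAll φ t xs) ys →
  insertAll φ t (xs ++ ys) ≡ insertAll ψ t (xs ++ ys)
insertAll-cong-++ φ ψ t xs ys front back =
  trans (insertAll-++ φ t xs ys)
        (trans back (trans (cong (λ s → insertAll ψ s ys) front) (sym (insertAll-++ ψ t xs ys))))

OffPair : ℕ → ℕ → ℕ → ℕ → Set
OffPair n a b x = x ≤ n × x ≢ a × x ≢ b

-- Only positions ≤ n are constrained: the maps of the theorem are arbitrary beyond their domain.
module SinglePairChange (φ ψ : ℕ → ℚ) (n a b : ℕ) (a≤n : a ≤ n) (b≤n : b ≤ n)
  (differ : ∀ x y → x ≤ n → y ≤ n → ¬ SamePair a b x y → (φ x <ᵇ φ y) ≡ (ψ x <ᵇ ψ y)) where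

  Other : ℕ → Set
  Other = OffPair n a b

  other-agrees : ∀ {x y} → Other x → y ≤ n → (φ x <ᵇ φ y) ≡ (ψ x <ᵇ ψ y)
  other-agrees (x≤n , x≢a , x≢b) y≤n = differ _ _ x≤n y≤n λ
    { (inj₁ (x≡a , _)) → x≢a x≡a
    ; (inj₂ (x≡b , _)) → x≢b x≡b }

  agrees-other : ∀ {x y} → x ≤ n → Other y → (φ x <ᵇ φ y) ≡ (ψ x <ᵇ ψ y)
  agrees-other x≤n (y≤n , y≢a , y≢b) = differ _ _ x≤n y≤n λ
    { (inj₁ (_ , y≡b)) → y≢b y≡b
    ; (inj₂ (_ , y≡a)) → y≢a y≡a }

  others≤n : ∀ {xs} → All Other xs → All (_≤ n) xs
  others≤n = All.map proj₁

  insertAll-cong-others : ∀ t xs → InRange n t → All Other xs → insertAll φ t xs ≡ insertAll ψ t xs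
  insertAll-cong-others t xs t≤n others = insertAll-cong φ ψ t xs λ x y x∈xs y∈ →
    other-agrees (All.lookup others x∈xs) (range y∈)
    where
    range : ∀ {y} → y ∈ inorder t ++ xs → y ≤ n
    range y∈ with ∈-++⁻ (inorder t) y∈
    ... | inj₁ p = t≤n _ p
    ... | inj₂ p = proj₁ (All.lookup others p)

  insertR-cong-other : ∀ x t → Other x → InRange n t → insertR φ x t ≡ insertR ψ x t
  insertR-cong-other x t other t≤n =
    insertR-cong φ ψ x t (λ y p → other-agrees other (t≤n y (spine⊆inorder t p)))

  insertR-cong-spine : ∀ x t → x ≤ n → (∀ y → y ∈ spine t → Other y) → insertR φ x t ≡ insertR ψ x t
  insertR-cong-spine x t x≤n others = insertR-cong φ ψ x t (λ y p → agrees-other x≤n (others y p))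

  insertAll-cong-separated : ∀ pre mid post {c} → All Other pre → All Other mid → All Other post →
    c ∈ mid → (φ c <ᵇ φ a) ≡ false →
    insertAll φ empty (pre ++ a ∷ mid ++ b ∷ post) ≡ insertAll ψ empty (pre ++ a ∷ mid ++ b ∷ post)
  insertAll-cong-separated pre mid post {c} o-pre o-mid o-post c∈mid c≮a with ∈-∃++ c∈mid
  ... | mid₁ , mid₂ , refl =
    subst (λ zs → insertAll φ empty (pre ++ a ∷ zs) ≡ insertAll ψ empty (pre ++ a ∷ zs))
      (sym (++-assoc mid₁ (c ∷ mid₂) (b ∷ post)))
      (insertAll-cong-++ φ ψ empty pre (a ∷ mid₁ ++ c ∷ mid₂ ++ b ∷ post)
        (insertAll-cong-others empty pre (λ _ ()) o-pre)
      (insertAll-cong-∷ φ ψ a T₁ (mid₁ ++ c ∷ mid₂ ++ b ∷ post) (insertR-cong-spine a T₁ a≤n spine-T₁)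
      (insertAll-cong-++ φ ψ T₂ mid₁ (c ∷ mid₂ ++ b ∷ post) (insertAll-cong-others T₂ mid₁ range-T₂ o-mid₁)
      (insertAll-cong-∷ φ ψ c T₃ (mid₂ ++ b ∷ post) (insertR-cong-other c T₃ o-c range-T₃)
      (insertAll-cong-++ φ ψ T₄ mid₂ (b ∷ post) (insertAll-cong-others T₄ mid₂ range-T₄ o-mid₂)
      (insertAll-cong-∷ φ ψ b T₅ post (insertR-cong-spine b T₅ b≤n spine-T₅)
      (insertAll-cong-others (insertR φ b T₅) post (inRange-insertR φ b T₅ range-T₅ b≤n) o-post)))))))
    where
    o-mid₁ = AllP.++⁻ˡ mid₁ o-mid
    o-c    = All.head (AllP.++⁻ʳ mid₁ o-mid)
    o-mid₂ = All.tail (AllP.++⁻ʳ mid₁ o-mid)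
    T₁ = insertAll φ empty pre
    T₂ = insertR φ a T₁
    T₃ = insertAll φ T₂ mid₁
    T₄ = insertR φ c T₃
    T₅ = insertAll φ T₄ mid₂
    range-T₂ : InRange n T₂
    range-T₂ = inRange-insertR φ a T₁ (inRange-insertAll φ empty pre (λ _ ()) (others≤n o-pre)) a≤n
    range-T₃ : InRange n T₃
    range-T₃ = inRange-insertAll φ T₂ mid₁ range-T₂ (others≤n o-mid₁)
    range-T₄ : InRange n T₄
    range-T₄ = inRange-insertR φ c T₃ range-T₃ (proj₁ o-c)
    range-T₅ : InRange n T₅
    range-T₅ = inRange-insertAll φ T₄ mid₂ range-T₄ (others≤n o-mid₂)
    spine-T₁ : ∀ y → y ∈ spine T₁ → Other y
    spine-T₁ y p = All.lookup o-pre (spine-insertAll-empty φ pre p)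
    spine-T₅ : ∀ y → y ∈ spine T₅ → Other y
    spine-T₅ y p with spine-after-pivot φ T₁ a c mid₁ mid₂ c≮a p
    ... | inj₁ q               = All.lookup o-mid₂ q
    ... | inj₂ (inj₁ refl)     = o-c
    ... | inj₂ (inj₂ (inj₁ q)) = All.lookup o-mid₁ q
    ... | inj₂ (inj₂ (inj₂ q)) = spine-T₁ y q

  Twins : Set
  Twins = ∀ y → Other y → (φ a <ᵇ φ y) ≡ (φ b <ᵇ φ y) × (φ y <ᵇ φ a) ≡ (φ y <ᵇ φ b)

  insertAll-rot-adjacent : ∀ pre mid post → All Other pre → All Other mid → All Other post → Twins →
    All (λ x → φ x < φ a) mid → (φ b <ᵇ φ a) ≢ (ψ b <ᵇ ψ a) →
    Rot a b (insertAll φ empty (pre ++ a ∷ mid ++ b ∷ post)) (insertAll ψ empty (pre ++ a ∷ mid ++ b ∷ post))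
  insertAll-rot-adjacent pre mid post o-pre o-mid o-post twins mid<a flips
    with insertR-split φ a (insertAll φ empty pre)
  ... | C , A , split-a , labels-above =
    subst₂ (Rot a b)
      (sym (trans (insertAll-around φ empty pre a mid b post) (cong (λ s → insertAll φ (insertR φ b s) post) Xφ≡X)))
      (sym (trans (insertAll-around ψ empty pre a mid b post) (cong (λ s → insertAll ψ (insertR ψ b s) post) Xψ≡X)))
      (rot-insertAll φ ψ a b post post-alike rot-b)
    where
    T₁ = insertAll φ empty pre
    B  = insertAll φ empty mid
    X  = plug C (node A a B)

    o-label : ∀ y → y ∈ labels C → Other y
    o-label y p = All.lookup o-pre (spine-insertAll-empty φ pre (proj₂ (labels-above y p)))

    mid-below : ∀ x → x ∈ mid → (∀ y → y ∈ labels C → (φ x <ᵇ φ y) ≡ true) × (φ x <ᵇ φ a) ≡ true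
    mid-below x p = (λ y q → <⇒<ᵇ (ℚ.<-trans (All.lookup mid<a p) (<ᵇ⇒< {φ a} {φ y} (proj₁ (labels-above y q))))) ,
                    <⇒<ᵇ (All.lookup mid<a p)

    Xφ≡X : insertAll φ (insertR φ a T₁) mid ≡ X
    Xφ≡X = trans (cong (λ s → insertAll φ s mid) split-a) (insertAll-plug φ C A a empty mid mid-below)

    range-T₂ : InRange n (insertR φ a T₁)
    range-T₂ = inRange-insertR φ a T₁ (inRange-insertAll φ empty pre (λ _ ()) (others≤n o-pre)) a≤n

    Xψ≡X : insertAll ψ (insertR ψ a (insertAll ψ empty pre)) mid ≡ X
    Xψ≡X = begin
      insertAll ψ (insertR ψ a (insertAll ψ empty pre)) mid
        ≡⟨ cong (λ s → insertAll ψ (insertR ψ a s) mid) (insertAll-cong-others empty pre (λ _ ()) o-pre) ⟨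
      insertAll ψ (insertR ψ a T₁) mid
        ≡⟨ cong (λ s → insertAll ψ s mid)
             (insertR-cong-spine a T₁ a≤n (λ y p → All.lookup o-pre (spine-insertAll-empty φ pre p))) ⟨
      insertAll ψ (insertR φ a T₁) mid
        ≡⟨ insertAll-cong-others (insertR φ a T₁) mid range-T₂ o-mid ⟨
      insertAll φ (insertR φ a T₁) mid
        ≡⟨ Xφ≡X ⟩
      X ∎
      where open ≡-Reasoning

    b-below-labels : ∀ y → y ∈ labels C → (φ b <ᵇ φ y) ≡ true × (ψ b <ᵇ ψ y) ≡ true
    b-below-labels y p = φ-below , trans (sym (agrees-other b≤n (o-label y p))) φ-below
      where
      φ-below : (φ b <ᵇ φ y) ≡ true
      φ-below = trans (sym (proj₁ (twins y (o-label y p)))) (proj₁ (labels-above y p))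

    b-above-B : ∀ y → y ∈ spine B → (φ b <ᵇ φ y) ≡ false × (ψ b <ᵇ ψ y) ≡ false
    b-above-B y p = φ-above , trans (sym (agrees-other b≤n o-y)) φ-above
      where
      y∈mid = spine-insertAll-empty φ mid p
      o-y   = All.lookup o-mid y∈mid
      φ-above : (φ b <ᵇ φ y) ≡ false
      φ-above = ≮⇒<ᵇ≡false (ℚ.<-asym (<ᵇ⇒< {φ y} {φ b}
                  (trans (sym (proj₂ (twins y o-y))) (<⇒<ᵇ (All.lookup mid<a y∈mid)))))

    rot-b : Rot a b (insertR φ b X) (insertR ψ b X)
    rot-b = insertR-flip-plug φ ψ a b C A B b-below-labels b-above-B flips

    range-bX : InRange n (insertR φ b X)
    range-bX = inRange-insertR φ b X
      (subst (InRange n) Xφ≡X (inRange-insertAll φ (insertR φ a T₁) mid range-T₂ (others≤n o-mid))) b≤n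

    post-alike : ∀ x → x ∈ post →
      (∀ y → y ∈ inorder (insertR φ b X) ++ post → (φ x <ᵇ φ y) ≡ (ψ x <ᵇ ψ y)) × ComparesAlike φ ψ a b x
    post-alike x p = (λ y q → other-agrees o-x (range y q)) , (φ x <ᵇ φ a) , alike
      where
      o-x = All.lookup o-post p
      range : ∀ y → y ∈ inorder (insertR φ b X) ++ post → y ≤ n
      range y q with ∈-++⁻ (inorder (insertR φ b X)) q
      ... | inj₁ r = range-bX y r
      ... | inj₂ r = proj₁ (All.lookup o-post r)
      alike : ∀ u → u ≡ a ⊎ u ≡ b → (φ x <ᵇ φ u) ≡ (φ x <ᵇ φ a) × (ψ x <ᵇ ψ u) ≡ (φ x <ᵇ φ a)
      alike u (inj₁ refl) = refl , sym (other-agrees o-x a≤n)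
      alike u (inj₂ refl) = sym (proj₂ (twins x o-x)) ,
                            trans (sym (other-agrees o-x b≤n)) (sym (proj₂ (twins x o-x)))

-- Minimum nodes and pairings

IsLeast : (ℕ → ℚ) → (ℕ → Set) → ℕ → Set
IsLeast φ P y = P y × (∀ z → P z → ¬ φ z < φ y)

MinimumOf : (ℕ → ℚ) → (ℕ → Set) → Maybe ℕ → Set
MinimumOf φ P u = (u ≡ nothing × (∀ z → ¬ P z)) ⊎ ∃[ y ] (u ≡ just y × IsLeast φ P y)

MinimumOf-resp : ∀ {φ P Q u} → (∀ {z} → P z → Q z) → (∀ {z} → Q z → P z) → MinimumOf φ P u → MinimumOf φ Q u
MinimumOf-resp P⇒Q Q⇒P (inj₁ (e , none))           = inj₁ (e , λ z q → none z (Q⇒P q))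
MinimumOf-resp P⇒Q Q⇒P (inj₂ (y , e , Py , least)) = inj₂ (y , e , P⇒Q Py , λ z q → least z (Q⇒P q))

-- The helper of minNode, local to its where block in Defs.
pick : (ℕ → ℚ) → Maybe ℕ → Maybe ℕ → Maybe ℕ
pick φ nothing  v        = v
pick φ u        nothing  = u
pick φ (just x) (just y) = if φ y <ᵇ φ x then just y else just x

pick-spec : ∀ φ {P Q u v} → MinimumOf φ P u → MinimumOf φ Q v → MinimumOf φ (λ z → P z ⊎ Q z) (pick φ u v)
pick-spec φ (inj₁ (refl , noP)) (inj₁ (e , noQ)) =
  inj₁ (e , λ { z (inj₁ p) → noP z p ; z (inj₂ q) → noQ z q })
pick-spec φ (inj₁ (refl , noP)) (inj₂ (y , refl , Qy , least)) =
  inj₂ (y , refl , inj₂ Qy , λ { z (inj₁ p) → ⊥-elim (noP z p) ; z (inj₂ q) → least z q })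
pick-spec φ (inj₂ (y , refl , Py , least)) (inj₁ (refl , noQ)) =
  inj₂ (y , refl , inj₁ Py , λ { z (inj₁ p) → least z p ; z (inj₂ q) → ⊥-elim (noQ z q) })
pick-spec φ (inj₂ (y , refl , Py , least)) (inj₂ (y′ , refl , Qy′ , least′)) with φ y′ <ᵇ φ y in y′<y
... | true  = inj₂ (y′ , refl , inj₂ Qy′ , λ
  { z (inj₁ p) z<y′ → least z p (ℚ.<-trans z<y′ (<ᵇ⇒< {φ y′} {φ y} y′<y))
  ; z (inj₂ q) → least′ z q })
... | false = inj₂ (y , refl , inj₁ Py , λ
  { z (inj₁ p) → least z p
  ; z (inj₂ q) z<y → least′ z q (ℚ.<-≤-trans z<y (ℚ.≮⇒≥ (<ᵇ≡false⇒≮ {φ y′} {φ y} y′<y))) })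

minNode-node : ∀ φ l x r → minNode φ (node l x r) ≡ pick φ (pick φ (just x) (minNode φ l)) (minNode φ r)
minNode-node φ l x r with minNode φ l | minNode φ r
... | nothing | nothing = refl
... | nothing | just _  = refl
... | just y  | v with φ y <ᵇ φ x
...   | true  with v
...     | nothing = refl
...     | just _  = refl
minNode-node φ l x r | just y | v | false with v
...     | nothing = refl
...     | just _  = refl

minNode-spec : ∀ φ t → MinimumOf φ (_∈ inorder t) (minNode φ t)
minNode-spec φ empty        = inj₁ (refl , λ z ())
minNode-spec φ (node l x r) rewrite minNode-node φ l x r =
  MinimumOf-resp into outof
    (pick-spec φ (pick-spec φ (inj₂ (x , refl , refl , λ { z refl → ℚ.<-irrefl refl })) (minNode-spec φ l))
                 (minNode-spec φ r))
  where
  into : ∀ {z} → (z ≡ x ⊎ z ∈ inorder l) ⊎ z ∈ inorder r → z ∈ inorder (node l x r)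
  into (inj₁ (inj₁ refl)) = ∈-root l x r
  into (inj₁ (inj₂ p))    = ∈-left l x r p
  into (inj₂ p)           = ∈-right l x r p
  outof : ∀ {z} → z ∈ inorder (node l x r) → (z ≡ x ⊎ z ∈ inorder l) ⊎ z ∈ inorder r
  outof p with ∈-++⁻ (inorder l) p
  ... | inj₁ q         = inj₁ (inj₂ q)
  ... | inj₂ (here e)  = inj₁ (inj₁ e)
  ... | inj₂ (there q) = inj₂ q

Minimiser : (ℕ → ℚ) → BT → ℕ → Set
Minimiser φ t = IsLeast φ (_∈ inorder t)

minNode-cong : ∀ φ ψ t →
  (∀ y y′ → y ∈ inorder t → y′ ∈ inorder t → ψ y ≡ ψ y′ → y ≡ y′) →
  (∀ y y′ → Minimiser φ t y → Minimiser ψ t y′ → (φ y′ <ᵇ φ y) ≡ (ψ y′ <ᵇ ψ y)) →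
  minNode φ t ≡ minNode ψ t
minNode-cong φ ψ t injective agree with minNode-spec φ t | minNode-spec ψ t
... | inj₁ (e , _)         | inj₁ (e′ , _)          = trans e (sym e′)
... | inj₁ (_ , none)      | inj₂ (y′ , _ , y′∈ , _) = ⊥-elim (none y′ y′∈)
... | inj₂ (y , _ , y∈ , _) | inj₁ (_ , none)        = ⊥-elim (none y y∈)
... | inj₂ (y , e , least) | inj₂ (y′ , e′ , least′) =
  trans e (trans (cong just same) (sym e′))
  where
  same : y ≡ y′
  same with ℚ.<-cmp (ψ y) (ψ y′)
  ... | tri< y<y′ _ _ = ⊥-elim (proj₂ least′ y (proj₁ least) y<y′)
  ... | tri≈ _ y≈y′ _ = injective y y′ (proj₁ least) (proj₁ least′) y≈y′
  ... | tri> _ _ y′<y = ⊥-elim (proj₂ least y′ (proj₁ least′)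
          (<ᵇ⇒< {φ y′} {φ y} (trans (agree y y′ least least′) (<⇒<ᵇ y′<y))))

data Subtree (t : BT) : BT → Set where
  here  : Subtree t t
  inLeft  : ∀ {l x r} → Subtree t l → Subtree t (node l x r)
  inRight : ∀ {l x r} → Subtree t r → Subtree t (node l x r)

ancestor⇒subtree : ∀ a T {t} → t ∈ ancestors a T → Subtree t T
ancestor⇒subtree a empty ()
ancestor⇒subtree a (node l x r) p with memᵇ a l
... | true with ∈-++⁻ (ancestors a l) p
...   | inj₁ q         = inLeft (ancestor⇒subtree a l q)
...   | inj₂ (here refl) = here
ancestor⇒subtree a (node l x r) p | false with memᵇ a r
... | true with ∈-++⁻ (ancestors a r) p
...   | inj₁ q         = inRight (ancestor⇒subtree a r q)
...   | inj₂ (here refl) = here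
ancestor⇒subtree a (node l x r) () | false | false

partner-cong : ∀ φ ψ a ts → (∀ t → t ∈ ts → minNode φ t ≡ minNode ψ t) → partner φ a ts ≡ partner ψ a ts
partner-cong φ ψ a []       same = refl
partner-cong φ ψ a (t ∷ ts) same rewrite same t (here refl) with isJustEq a (minNode ψ t)
... | true  = partner-cong φ ψ a ts (λ t′ p → same t′ (there p))
... | false = refl

pairing-cong : ∀ φ ψ D → (∀ t → Subtree t D → minNode φ t ≡ minNode ψ t) → pairing φ D ≡ pairing ψ D
pairing-cong φ ψ D same = map-cong
  (λ a → cong (a ,_) (partner-cong φ ψ a (ancestors a D) (λ t p → same t (ancestor⇒subtree a D p))))
  (leaves D)

subtree⇒infix : ∀ {t T} → Subtree t T → ∃[ us ] ∃[ vs ] (inorder T ≡ us ++ inorder t ++ vs)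
subtree⇒infix {t} here = [] , [] , sym (++-identityʳ (inorder t))
subtree⇒infix {t} (inLeft {l} {x} {r} sub) with subtree⇒infix sub
... | us , vs , eq = us , vs ++ x ∷ inorder r , (begin
  inorder l ++ x ∷ inorder r          ≡⟨ cong (_++ x ∷ inorder r) eq ⟩
  (us ++ inorder t ++ vs) ++ x ∷ inorder r ≡⟨ ++-assoc us (inorder t ++ vs) (x ∷ inorder r) ⟩
  us ++ (inorder t ++ vs) ++ x ∷ inorder r ≡⟨ cong (us ++_) (++-assoc (inorder t) vs (x ∷ inorder r)) ⟩
  us ++ inorder t ++ vs ++ x ∷ inorder r ∎)
  where open ≡-Reasoning
subtree⇒infix {t} (inRight {l} {x} {r} sub) with subtree⇒infix sub
... | us , vs , eq = inorder l ++ x ∷ us , vs , (begin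
  inorder l ++ x ∷ inorder r               ≡⟨ cong (λ s → inorder l ++ x ∷ s) eq ⟩
  inorder l ++ x ∷ us ++ inorder t ++ vs   ≡⟨ ++-assoc (inorder l) (x ∷ us) (inorder t ++ vs) ⟨
  (inorder l ++ x ∷ us) ++ inorder t ++ vs ∎)
  where open ≡-Reasoning

module _ {R : ℕ → ℕ → Set} where

  AllPairs-++⁻ʳ : ∀ xs {ys} → AllPairs R (xs ++ ys) → AllPairs R ys
  AllPairs-++⁻ʳ []       ps       = ps
  AllPairs-++⁻ʳ (x ∷ xs) (_ ∷ ps) = AllPairs-++⁻ʳ xs ps

  AllPairs-across : ∀ xs {ys x y} → AllPairs R (xs ++ ys) → x ∈ xs → y ∈ ys → R x y
  AllPairs-across (x ∷ xs) (p ∷ _)  (here refl) y∈ = All.lookup p (∈-++⁺ʳ xs y∈)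
  AllPairs-across (x ∷ xs) (_ ∷ ps) (there x∈)  y∈ = AllPairs-across xs ps x∈ y∈

Sorted : List ℕ → Set
Sorted = AllPairs _<ₙ_

sorted-infix-between : ∀ us ys vs {x z k} → Sorted (us ++ ys ++ vs) → x ∈ ys → z ∈ ys →
  k ∈ us ++ ys ++ vs → x <ₙ k → k <ₙ z → k ∈ ys
sorted-infix-between us ys vs sorted x∈ z∈ k∈ x<k k<z with ∈-++⁻ us k∈
... | inj₁ k∈us = ⊥-elim (ℕ.<-asym x<k (AllPairs-across us sorted k∈us (∈-++⁺ˡ x∈)))
... | inj₂ k∈rest with ∈-++⁻ ys k∈rest
...   | inj₁ k∈ys = k∈ys
...   | inj₂ k∈vs = ⊥-elim (ℕ.<-asym k<z (AllPairs-across ys (AllPairs-++⁻ʳ us sorted) z∈ k∈vs))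

sorted-split : ∀ {xs a b} → Sorted xs → a ∈ xs → b ∈ xs → a <ₙ b →
  ∃[ pre ] ∃[ mid ] ∃[ post ] (xs ≡ pre ++ a ∷ mid ++ b ∷ post ×
    All (_<ₙ a) pre × All (λ x → a <ₙ x × x <ₙ b) mid × All (b <ₙ_) post)
sorted-split {a = a} {b} sorted a∈ b∈ a<b with ∈-∃++ a∈
... | pre , rest , refl with ∈-++⁻ pre b∈
...   | inj₁ b∈pre = ⊥-elim (ℕ.<-asym a<b (AllPairs-across pre sorted b∈pre (here refl)))
...   | inj₂ (here refl) = ⊥-elim (ℕ.<-irrefl refl a<b)
...   | inj₂ (there b∈rest) with ∈-∃++ b∈rest
...     | mid , post , refl =
  pre , mid , post , refl ,
  All.tabulate (λ x∈ → AllPairs-across pre sorted x∈ (here refl)) ,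
  All.tabulate (λ x∈ → All.lookup (AllPairs.head a-sorted) (∈-++⁺ˡ x∈) ,
                        AllPairs-across mid (AllPairs.tail a-sorted) x∈ (here refl)) ,
  AllPairs.head (AllPairs-++⁻ʳ mid (AllPairs.tail a-sorted))
  where
  a-sorted : Sorted (a ∷ mid ++ b ∷ post)
  a-sorted = AllPairs-++⁻ʳ pre sorted

∈-between : ∀ {pre mid post a b x} → All (_<ₙ a) pre → All (b <ₙ_) post →
  x ∈ pre ++ a ∷ mid ++ b ∷ post → a <ₙ x → x <ₙ b → x ∈ mid
∈-between {pre} {mid} pre<a b<post x∈ a<x x<b with ∈-++⁻ pre x∈
... | inj₁ x∈pre = ⊥-elim (ℕ.<-asym a<x (All.lookup pre<a x∈pre))
... | inj₂ (here refl) = ⊥-elim (ℕ.<-irrefl refl a<x)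
... | inj₂ (there x∈rest) with ∈-++⁻ mid x∈rest
...   | inj₁ x∈mid = x∈mid
...   | inj₂ (here refl) = ⊥-elim (ℕ.<-irrefl refl x<b)
...   | inj₂ (there x∈post) = ⊥-elim (ℕ.<-asym x<b (All.lookup b<post x∈post))

isCritᵇ : (ℕ → ℚ) → ℕ → ℕ → Bool
isCritᵇ φ m i = isMinᵇ φ m i ∨ isMaxᵇ φ m i

filterᵇ-cong : ∀ (p p′ : ℕ → Bool) xs → (∀ i → i ∈ xs → p i ≡ p′ i) → filterᵇ p xs ≡ filterᵇ p′ xs
filterᵇ-cong p p′ []       same = refl
filterᵇ-cong p p′ (x ∷ xs) same with p x | p′ x | same x (here refl)
... | true  | .true  | refl = cong (x ∷_) (filterᵇ-cong p p′ xs (λ i q → same i (there q)))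
... | false | .false | refl = filterᵇ-cong p p′ xs (λ i q → same i (there q))

crits-sorted : ∀ φ m → Sorted (crits φ m)
crits-sorted φ m = AllPairsP.filter⁺ (T? ∘ isCritᵇ φ m) (AllPairsP.applyUpTo⁺₁ id (suc (suc m)) (λ i<j _ → i<j))

crits-bounded : ∀ φ m {x} → x ∈ crits φ m → x ≤ suc m
crits-bounded φ m p = ℕ.≤-pred (∈-upTo⁻ (proj₁ (∈-filter⁻ (T? ∘ isCritᵇ φ m) p)))

crit⇒∈crits : ∀ φ m {x} → x ≤ suc m → isCritᵇ φ m x ≡ true → x ∈ crits φ m
crit⇒∈crits φ m x≤ crit = ∈-filter⁺ (T? ∘ isCritᵇ φ m) (∈-upTo⁺ (s≤s x≤)) (subst T (sym crit) tt)

≡ᵇ-∨ : ∀ x n {c} → x ≡ n ⊎ c ≡ true → ((x ≡ᵇ n) ∨ c) ≡ true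
≡ᵇ-∨ x n (inj₁ refl) with x ≡ᵇ x in x≡ᵇx
... | true  = refl
... | false = ⊥-elim (subst T x≡ᵇx (ℕ.≡⇒≡ᵇ x x refl))
≡ᵇ-∨ x n (inj₂ refl) = ∨-zeroʳ (x ≡ᵇ n)

isMax⇒isCritᵇ : ∀ φ m {x} → IsMax φ m x → isCritᵇ φ m x ≡ true
isMax⇒isCritᵇ φ m {x} (left , right′) =
  trans (cong (isMinᵇ φ m x ∨_) (cong₂ _∧_ (≡ᵇ-∨ x 0 (map₂ <⇒<ᵇ left))
                                          (≡ᵇ-∨ x (suc m) (map₂ <⇒<ᵇ right′))))
        (∨-zeroʳ (isMinᵇ φ m x))

strictMin⇒isCritᵇ : ∀ φ m {x} → φ x < φ (x ∸ 1) → φ x < φ (suc x) → isCritᵇ φ m x ≡ true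
strictMin⇒isCritᵇ φ m {x} below-pred below-succ =
  cong (_∨ isMaxᵇ φ m x) (cong₂ _∧_ (≡ᵇ-∨ x 0 (inj₂ (<⇒<ᵇ below-pred))) (≡ᵇ-∨ x (suc m) (inj₂ (<⇒<ᵇ below-succ))))

crits-cong : ∀ φ ψ m → (∀ i → i ≤ suc m → isCritᵇ φ m i ≡ isCritᵇ ψ m i) → crits φ m ≡ crits ψ m
crits-cong φ ψ m same = filterᵇ-cong (isCritᵇ φ m) (isCritᵇ ψ m) (upTo (suc (suc m)))
  (λ i p → same i (ℕ.≤-pred (∈-upTo⁻ p)))

crits-neg : ∀ φ m → crits (neg φ) m ≡ crits φ m
crits-neg φ m = crits-cong (neg φ) φ m λ i _ →
  trans (cong₂ _∨_ (isMin-neg i) (isMax-neg i)) (∨-comm (isMaxᵇ φ m i) (isMinᵇ φ m i))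
  where
  isMin-neg : ∀ i → isMinᵇ (neg φ) m i ≡ isMaxᵇ φ m i
  isMin-neg i rewrite neg-<ᵇ (φ i) (φ (i ∸ 1)) | neg-<ᵇ (φ i) (φ (suc i)) = refl
  isMax-neg : ∀ i → isMaxᵇ (neg φ) m i ≡ isMinᵇ φ m i
  isMax-neg i rewrite neg-<ᵇ (φ (i ∸ 1)) (φ i) | neg-<ᵇ (φ (suc i)) (φ i) = refl

crits-cong-neighbours : ∀ φ ψ m →
  (∀ i → suc i ≤ suc m → (φ i <ᵇ φ (suc i)) ≡ (ψ i <ᵇ ψ (suc i)) × (φ (suc i) <ᵇ φ i) ≡ (ψ (suc i) <ᵇ ψ i)) →
  crits φ m ≡ crits ψ m
crits-cong-neighbours φ ψ m neighbours = crits-cong φ ψ m λ i i≤ →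
  cong₂ _∨_ (cong₂ _∧_ (proj₁ (towards-pred i i≤)) (proj₁ (towards-succ i i≤)))
            (cong₂ _∧_ (proj₂ (towards-pred i i≤)) (proj₂ (towards-succ i i≤)))
  where
  towards-pred : ∀ i → i ≤ suc m →
    ((i ≡ᵇ 0) ∨ (φ i <ᵇ φ (i ∸ 1))) ≡ ((i ≡ᵇ 0) ∨ (ψ i <ᵇ ψ (i ∸ 1))) ×
    ((i ≡ᵇ 0) ∨ (φ (i ∸ 1) <ᵇ φ i)) ≡ ((i ≡ᵇ 0) ∨ (ψ (i ∸ 1) <ᵇ ψ i))
  towards-pred zero    _  = refl , refl
  towards-pred (suc k) le = proj₂ (neighbours k le) , proj₁ (neighbours k le)
  towards-succ : ∀ i → i ≤ suc m →
    ((i ≡ᵇ suc m) ∨ (φ i <ᵇ φ (suc i))) ≡ ((i ≡ᵇ suc m) ∨ (ψ i <ᵇ ψ (suc i))) ×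
    ((i ≡ᵇ suc m) ∨ (φ (suc i) <ᵇ φ i)) ≡ ((i ≡ᵇ suc m) ∨ (ψ (suc i) <ᵇ ψ i))
  towards-succ i le with i ≡ᵇ suc m in at-end
  ... | true  = refl , refl
  ... | false = neighbours i (ℕ.≤∧≢⇒< le λ { refl → subst T at-end (ℕ.≡⇒≡ᵇ i i refl) })

p<p+q : ∀ p {q} → 0ℚ < q → p < p + q
p<p+q p 0<q = subst (_< p + _) (ℚ.+-identityʳ p) (ℚ.+-monoʳ-< p 0<q)

p-q<p : ∀ p {q} → 0ℚ < q → p - q < p
p-q<p p 0<q = subst (p - _ <_) (ℚ.+-identityʳ p) (ℚ.+-monoʳ-< p (ℚ.neg-antimono-< 0<q))

p+q-q≡p : ∀ p q → p + q - q ≡ p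
p+q-q≡p p q = trans (ℚ.+-assoc p q (- q)) (trans (cong (p +_) (ℚ.+-inverseʳ q)) (ℚ.+-identityʳ p))

p+[q-p]≡q : ∀ p q → p + (q - p) ≡ q
p+[q-p]≡q p q = trans (sym (ℚ.+-assoc p q (- p))) (xyx⁻¹≈y p q)
  where open import Algebra.Properties.AbelianGroup ℚ.+-0-abelianGroup using (xyx⁻¹≈y)

p<q⇒0<q-p : ∀ {p q} → p < q → 0ℚ < q - p
p<q⇒0<q-p {p} {q} p<q = subst (_< q - p) (ℚ.+-inverseʳ p) (ℚ.+-monoˡ-< (- p) p<q)

<q-p⇒p+<q : ∀ {p q ε} → ε < q - p → p + ε < q
<q-p⇒p+<q {p} {q} ε<q-p = subst (p + _ <_) (p+[q-p]≡q p q) (ℚ.+-monoʳ-< p ε<q-p)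

<⊓⇒<×< : ∀ {ε p q} → ε < p ⊓ q → ε < p × ε < q
<⊓⇒<×< {ε} {p} {q} ε<p⊓q = ℚ.<-≤-trans ε<p⊓q (ℚ.p⊓q≤p p q) , ℚ.<-≤-trans ε<p⊓q (ℚ.p⊓q≤q p q)

<×<⇒<⊓ : ∀ {ε p q} → ε < p → ε < q → ε < p ⊓ q
<×<⇒<⊓ {ε} {p} {q} ε<p ε<q with ℚ.⊓-sel p q
... | inj₁ p⊓q≡p = subst (ε <_) (sym p⊓q≡p) ε<p
... | inj₂ p⊓q≡q = subst (ε <_) (sym p⊓q≡q) ε<q

Separated : ℚ → ℚ → ℚ → Set
Separated ε v w = (w < v → w + ε < v) × (v < w → v + ε < w)

isolation : ∀ v (h : ℕ → ℚ) n →
  ∃[ ε₀ ] (0ℚ < ε₀ × (∀ ε → ε < ε₀ → ∀ i → i <ₙ n → Separated ε v (h i)))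
isolation v h zero    = 1ℚ , ℚ.positive⁻¹ 1ℚ , λ ε _ i ()
isolation v h (suc n) with isolation v h n | gap (ℚ.<-cmp (h n) v)
  where
  gap : _ → ∃[ d ] (0ℚ < d × (∀ ε → ε < d → Separated ε v (h n)))
  gap (tri< hn<v _ _) = v - h n , p<q⇒0<q-p hn<v ,
    λ ε ε<d → (λ _ → <q-p⇒p+<q ε<d) , (λ v<hn → ⊥-elim (ℚ.<-asym hn<v v<hn))
  gap (tri≈ _ hn≡v _) = 1ℚ , ℚ.positive⁻¹ 1ℚ ,
    λ ε _ → (λ hn<v → ⊥-elim (ℚ.<-irrefl hn≡v hn<v)) , (λ v<hn → ⊥-elim (ℚ.<-irrefl (sym hn≡v) v<hn))
  gap (tri> _ _ v<hn) = h n - v , p<q⇒0<q-p v<hn ,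
    λ ε ε<d → (λ hn<v → ⊥-elim (ℚ.<-asym hn<v v<hn)) , (λ _ → <q-p⇒p+<q ε<d)
... | ε₁ , 0<ε₁ , sep₁ | d , 0<d , sep-n = ε₁ ⊓ d , <×<⇒<⊓ 0<ε₁ 0<d , sep
  where
  sep : ∀ ε → ε < ε₁ ⊓ d → ∀ i → i <ₙ suc n → Separated ε v (h i)
  sep ε ε< i i<1+n with ℕ.m≤n⇒m<n∨m≡n (ℕ.≤-pred i<1+n)
  ... | inj₁ i<n  = sep₁ ε (proj₁ (<⊓⇒<×< {p = ε₁} ε<)) i i<n
  ... | inj₂ refl = sep-n ε (proj₂ (<⊓⇒<×< {p = ε₁} ε<))

perturb-at : ∀ φ j δ → perturb φ j δ j ≡ φ j + δ
perturb-at φ j δ with j ≡ᵇ j in j≡ᵇj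
... | true  = refl
... | false = ⊥-elim (subst T j≡ᵇj (ℕ.≡⇒≡ᵇ j j refl))

perturb-off : ∀ φ j δ {x} → x ≢ j → perturb φ j δ x ≡ φ x
perturb-off φ j δ {x} x≢j with x ≡ᵇ j in x≡ᵇj
... | true  = ⊥-elim (x≢j (ℕ.≡ᵇ⇒≡ x j (subst T (sym x≡ᵇj) tt)))
... | false = refl

samePair-sym : ∀ {a b c d} → SamePair a b c d → SamePair c d a b
samePair-sym (inj₁ (refl , refl)) = inj₁ (refl , refl)
samePair-sym (inj₂ (refl , refl)) = inj₂ (refl , refl)

samePair-trans : ∀ {a b c d x y} → SamePair a b c d → SamePair c d x y → SamePair a b x y
samePair-trans (inj₁ (refl , refl)) sp                   = sp
samePair-trans (inj₂ (refl , refl)) (inj₁ (refl , refl)) = inj₂ (refl , refl)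
samePair-trans (inj₂ (refl , refl)) (inj₂ (refl , refl)) = inj₁ (refl , refl)

samePair-swap : ∀ {a b x y} → SamePair a b x y → SamePair a b y x
samePair-swap (inj₁ (x≡a , y≡b)) = inj₂ (y≡b , x≡a)
samePair-swap (inj₂ (x≡b , y≡a)) = inj₁ (y≡a , x≡b)

avoids-samePair : ∀ {a b c d x} → SamePair a b c d → x ≢ c → x ≢ d → x ≢ a × x ≢ b
avoids-samePair (inj₁ (refl , refl)) x≢c x≢d = x≢c , x≢d
avoids-samePair (inj₂ (refl , refl)) x≢c x≢d = x≢d , x≢c

samePair? : ∀ a b x y → Dec (SamePair a b x y)
samePair? a b x y = ((x ℕ.≟ a) ×-dec (y ℕ.≟ b)) ⊎-dec ((x ℕ.≟ b) ×-dec (y ℕ.≟ a))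

pred≢self : ∀ {x y} → y <ₙ x → x ∸ 1 ≢ x
pred≢self {suc x} _ = ℕ.1+n≢n ∘ sym

interval-argmin : ∀ (h : ℕ → ℚ) a b → a ≤ b →
  ∃[ c ] (a ≤ c × c ≤ b × (∀ i → a ≤ i → i ≤ b → ¬ h i < h c))
interval-argmin h a zero a≤0 = a , ℕ.≤-refl , a≤0 , λ i a≤i i≤0 →
  ℚ.<-irrefl (cong h (trans (ℕ.n≤0⇒n≡0 i≤0) (sym (ℕ.n≤0⇒n≡0 a≤0))))
interval-argmin h a (suc b) a≤1+b with a ℕ.≤? b
... | no a≰b = a , ℕ.≤-refl , a≤1+b , λ i a≤i i≤1+b →
  ℚ.<-irrefl (cong h (ℕ.≤-antisym (ℕ.≤-trans i≤1+b (ℕ.≰⇒> a≰b)) a≤i))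
... | yes a≤b with interval-argmin h a b a≤b
...   | c , a≤c , c≤b , least with h (suc b) <? h c
...     | yes new = suc b , a≤1+b , ℕ.≤-refl , λ i a≤i i≤1+b → case-last i a≤i i≤1+b
  where
  case-last : ∀ i → a ≤ i → i ≤ suc b → ¬ h i < h (suc b)
  case-last i a≤i i≤1+b with ℕ.m≤n⇒m<n∨m≡n i≤1+b
  ... | inj₁ (s≤s i≤b) = λ i<new → least i a≤i i≤b (ℚ.<-trans i<new new)
  ... | inj₂ refl      = ℚ.<-irrefl refl
...     | no old = c , a≤c , ℕ.m≤n⇒m≤1+n c≤b , λ i a≤i i≤1+b → case-last i a≤i i≤1+b
  where
  case-last : ∀ i → a ≤ i → i ≤ suc b → ¬ h i < h c
  case-last i a≤i i≤1+b with ℕ.m≤n⇒m<n∨m≡n i≤1+b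
  ... | inj₁ (s≤s i≤b) = least i a≤i i≤b
  ... | inj₂ refl      = old

-- Two maxima of equal value

module TwoEqualMaxima (m : ℕ) (F : ℕ → ℚ) (j q : ℕ) (j≤ : j ≤ suc m) (q≤ : q ≤ suc m) (j≢q : j ≢ q)
  (max-j : IsMax F m j) (max-q : IsMax F m q) (Fj≡Fq : F j ≡ F q)
  (distinct : ∀ x y → x ≤ suc m → y ≤ suc m → x ≢ y → F x ≡ F y → SamePair j q x y) where

  InPair : ℕ → Set
  InPair u = u ≡ j ⊎ u ≡ q

  ε₀ : ℚ
  ε₀ = proj₁ (isolation (F j) F (suc (suc m)))

  0<ε₀ : 0ℚ < ε₀
  0<ε₀ = proj₁ (proj₂ (isolation (F j) F (suc (suc m))))

  separated : ∀ ε → ε < ε₀ → ∀ y → y ≤ suc m → Separated ε (F j) (F y)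
  separated ε ε<ε₀ y y≤ = proj₂ (proj₂ (isolation (F j) F (suc (suc m)))) ε ε<ε₀ y (s≤s y≤)

  SameSide : ℚ → Set
  SameSide w = ∀ y → y ≤ suc m → (F y < F j → F y < w) × (F j < F y → w < F y)

  Good : (ℕ → ℚ) → Set
  Good φ = (∀ x → x ≢ j → φ x ≡ F x) × SameSide (φ j)

  good-perturb : ∀ δ → SameSide (F j + δ) → Good (perturb F j δ)
  good-perturb δ side = (λ x → perturb-off F j δ) , subst SameSide (sym (perturb-at F j δ)) side

  sameSide-up : ∀ {ε} → 0ℚ < ε → ε < ε₀ → SameSide (F j + ε)
  sameSide-up {ε} 0<ε ε<ε₀ y y≤ =
    (λ y<j → ℚ.<-trans y<j (p<p+q (F j) 0<ε)) , proj₂ (separated ε ε<ε₀ y y≤)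

  sameSide-down : ∀ {ε} → 0ℚ < ε → ε < ε₀ → SameSide (F j - ε)
  sameSide-down {ε} 0<ε ε<ε₀ y y≤ =
    (λ y<j → subst (_< F j - ε) (p+q-q≡p (F y) ε) (ℚ.+-monoˡ-< (- ε) (proj₁ (separated ε ε<ε₀ y y≤) y<j))) ,
    (λ j<y → ℚ.<-trans (p-q<p (F j) 0<ε) j<y)

  sameSide-pair : ∀ {φ u} → Good φ → InPair u → SameSide (φ u)
  sameSide-pair good (inj₁ refl) = proj₂ good
  sameSide-pair good (inj₂ refl) = subst SameSide (trans Fj≡Fq (sym (proj₁ good q (j≢q ∘ sym))))
                                     (λ y _ → id , id)

  off-pair-distinct : ∀ {y} → y ≤ suc m → y ≢ j → y ≢ q → F y ≢ F j
  off-pair-distinct y≤ y≢j y≢q Fy≡Fj with distinct _ j y≤ j≤ y≢j Fy≡Fj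
  ... | inj₁ (y≡j , _) = y≢j y≡j
  ... | inj₂ (y≡q , _) = y≢q y≡q

  sameSide-compare : ∀ {w y} → SameSide w → y ≤ suc m → F y ≢ F j →
    (w <ᵇ F y) ≡ (F j <ᵇ F y) × (F y <ᵇ w) ≡ (F y <ᵇ F j)
  sameSide-compare {w} {y} side y≤ Fy≢Fj with ℚ.<-cmp (F y) (F j)
  ... | tri< y<j _ _ = trans (≮⇒<ᵇ≡false (ℚ.<-asym (proj₁ (side y y≤) y<j))) (sym (≮⇒<ᵇ≡false (ℚ.<-asym y<j))) ,
                       trans (<⇒<ᵇ (proj₁ (side y y≤) y<j)) (sym (<⇒<ᵇ y<j))
  ... | tri≈ _ y≈j _ = ⊥-elim (Fy≢Fj y≈j)
  ... | tri> _ _ j<y = trans (<⇒<ᵇ (proj₂ (side y y≤) j<y)) (sym (<⇒<ᵇ j<y)) ,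
                       trans (≮⇒<ᵇ≡false (ℚ.<-asym (proj₂ (side y y≤) j<y))) (sym (≮⇒<ᵇ≡false (ℚ.<-asym j<y)))

  pair-compare : ∀ {φ u y} → Good φ → InPair u → y ≤ suc m → y ≢ j → y ≢ q →
    (φ u <ᵇ φ y) ≡ (F j <ᵇ F y) × (φ y <ᵇ φ u) ≡ (F y <ᵇ F j)
  pair-compare {φ} {u} {y} good u∈ y≤ y≢j y≢q rewrite proj₁ good y y≢j =
    sameSide-compare (sameSide-pair good u∈) y≤ (off-pair-distinct y≤ y≢j y≢q)

  good-agrees : ∀ {φ} → Good φ → ∀ x y → x ≤ suc m → y ≤ suc m → ¬ SamePair j q x y →
    (φ x <ᵇ φ y) ≡ (F x <ᵇ F y)
  good-agrees {φ} good x y x≤ y≤ ¬pair with x ℕ.≟ j | y ℕ.≟ j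
  ... | yes refl | yes refl = trans (<ᵇ-irrefl (φ x)) (sym (<ᵇ-irrefl (F x)))
  ... | yes refl | no y≢j   = proj₁ (pair-compare good (inj₁ refl) y≤ y≢j (λ y≡q → ¬pair (inj₁ (refl , y≡q))))
  ... | no x≢j   | yes refl = proj₂ (pair-compare good (inj₁ refl) x≤ x≢j (λ x≡q → ¬pair (inj₂ (x≡q , refl))))
  ... | no x≢j   | no y≢j rewrite proj₁ good x x≢j | proj₁ good y y≢j = refl

  good-differ : ∀ {φ ψ} → Good φ → Good ψ → ∀ x y → x ≤ suc m → y ≤ suc m → ¬ SamePair j q x y →
    (φ x <ᵇ φ y) ≡ (ψ x <ᵇ ψ y)
  good-differ gφ gψ x y x≤ y≤ ¬pair = trans (good-agrees gφ x y x≤ y≤ ¬pair) (sym (good-agrees gψ x y x≤ y≤ ¬pair))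

  equal-maxima-not-adjacent : ∀ {u v} → u ≤ suc m → v ≤ suc m → IsMax F m u → F u ≡ F v → suc u ≢ v
  equal-maxima-not-adjacent u≤ v≤ (_ , inj₁ refl) _ refl = ℕ.1+n≰n v≤
  equal-maxima-not-adjacent u≤ v≤ (_ , inj₂ su<u) Fu≡Fv refl = ℚ.<-irrefl (sym Fu≡Fv) su<u

  nonadjacent : ∀ i → ¬ SamePair j q i (suc i) × ¬ SamePair j q (suc i) i
  nonadjacent i = (λ { (inj₁ (refl , e)) → j→q e ; (inj₂ (refl , e)) → q→j e }) ,
                  (λ { (inj₁ (e , refl)) → q→j e ; (inj₂ (e , refl)) → j→q e })
    where
    j→q = equal-maxima-not-adjacent j≤ q≤ max-j Fj≡Fq
    q→j = equal-maxima-not-adjacent q≤ j≤ max-q (sym Fj≡Fq)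

  good-crits : ∀ {φ} → Good φ → crits φ m ≡ crits F m
  good-crits {φ} good = crits-cong-neighbours φ F m λ i 1+i≤ →
    let i≤ = ℕ.≤-trans (ℕ.n≤1+n i) 1+i≤ in
    good-agrees good i (suc i) i≤ 1+i≤ (proj₁ (nonadjacent i)) ,
    good-agrees good (suc i) i 1+i≤ i≤ (proj₂ (nonadjacent i))

  moved-value-fresh : ∀ {φ y} → Good φ → φ j ≢ F j → y ≤ suc m → y ≢ j → φ j ≢ F y
  moved-value-fresh {φ} {y} good moved y≤ y≢j φj≡Fy with y ℕ.≟ q
  ... | yes refl = moved (trans φj≡Fy (sym Fj≡Fq))
  ... | no y≢q with ℚ.<-cmp (F y) (F j)
  ...   | tri< y<j _ _ = ℚ.<-irrefl (sym φj≡Fy) (proj₁ (proj₂ good y y≤) y<j)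
  ...   | tri≈ _ y≈j _ = off-pair-distinct y≤ y≢j y≢q y≈j
  ...   | tri> _ _ j<y = ℚ.<-irrefl φj≡Fy (proj₂ (proj₂ good y y≤) j<y)

  good-injective : ∀ {φ} → Good φ → φ j ≢ F j → ∀ x y → x ≤ suc m → y ≤ suc m → φ x ≡ φ y → x ≡ y
  good-injective {φ} good moved x y x≤ y≤ φx≡φy with x ℕ.≟ y | x ℕ.≟ j | y ℕ.≟ j
  ... | yes x≡y | _        | _        = x≡y
  ... | no _    | yes refl | yes refl = refl
  ... | no _    | yes refl | no y≢j   = ⊥-elim (moved-value-fresh good moved y≤ y≢j (trans φx≡φy (proj₁ good y y≢j)))
  ... | no _    | no x≢j   | yes refl = ⊥-elim (moved-value-fresh good moved x≤ x≢j (trans (sym φx≡φy) (proj₁ good x x≢j)))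
  ... | no x≢y  | no x≢j   | no y≢j
    with distinct x y x≤ y≤ x≢y (trans (sym (proj₁ good x x≢j)) (trans φx≡φy (proj₁ good y y≢j)))
  ...   | inj₁ (x≡j , _) = ⊥-elim (x≢j x≡j)
  ...   | inj₂ (_ , y≡j) = ⊥-elim (y≢j y≡j)

  pair-flips : ∀ {φ ψ a b} → Good φ → Good ψ → SamePair j q a b → φ j < F j → F j < ψ j →
    (φ b <ᵇ φ a) ≢ (ψ b <ᵇ ψ a)
  pair-flips {φ} {ψ} gφ gψ (inj₁ (refl , refl)) down up
    rewrite proj₁ gφ q (j≢q ∘ sym) | proj₁ gψ q (j≢q ∘ sym) | sym Fj≡Fq =
    λ e → not-¬ (<⇒<ᵇ up) (trans (sym e) (≮⇒<ᵇ≡false (ℚ.<-asym down)))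
  pair-flips {φ} {ψ} gφ gψ (inj₂ (refl , refl)) down up
    rewrite proj₁ gφ q (j≢q ∘ sym) | proj₁ gψ q (j≢q ∘ sym) | sym Fj≡Fq =
    λ e → not-¬ (<⇒<ᵇ down) (trans e (≮⇒<ᵇ≡false (ℚ.<-asym up)))

  module OrderedPair (a b : ℕ) (a<b : a <ₙ b) (ab : SamePair j q a b) where

    a∈ : InPair a
    a∈ = first∈pair ab

    b∈ : InPair b
    b∈ = second∈pair ab

    pair-bounded : ∀ {u} → InPair u → u ≤ suc m
    pair-bounded (inj₁ refl) = j≤
    pair-bounded (inj₂ refl) = q≤

    pair-max : ∀ {u} → InPair u → IsMax F m u
    pair-max (inj₁ refl) = max-j
    pair-max (inj₂ refl) = max-q

    pair-value : ∀ {u} → InPair u → F u ≡ F j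
    pair-value (inj₁ refl) = refl
    pair-value (inj₂ refl) = sym Fj≡Fq

    a≤ = pair-bounded a∈
    b≤ = pair-bounded b∈

    Other : ℕ → Set
    Other = OffPair (suc m) a b

    other-off-pair : ∀ {x} → Other x → x ≢ j × x ≢ q
    other-off-pair (_ , x≢a , x≢b) = avoids-samePair ab x≢a x≢b

    good-differ-ab : ∀ {φ ψ} → Good φ → Good ψ → ∀ x y → x ≤ suc m → y ≤ suc m → ¬ SamePair a b x y →
      (φ x <ᵇ φ y) ≡ (ψ x <ᵇ ψ y)
    good-differ-ab gφ gψ x y x≤ y≤ ¬pair = good-differ gφ gψ x y x≤ y≤ (¬pair ∘ samePair-trans (samePair-sym ab))

    neg-differ-ab : ∀ {φ ψ} → Good φ → Good ψ → ∀ x y → x ≤ suc m → y ≤ suc m → ¬ SamePair a b x y →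
      (neg φ x <ᵇ neg φ y) ≡ (neg ψ x <ᵇ neg ψ y)
    neg-differ-ab {φ} {ψ} gφ gψ x y x≤ y≤ ¬pair =
      trans (neg-<ᵇ (φ x) (φ y))
            (trans (good-differ-ab gφ gψ y x y≤ x≤ (¬pair ∘ samePair-swap)) (sym (neg-<ᵇ (ψ x) (ψ y))))

    twins : ∀ {φ} → Good φ → ∀ y → Other y → (φ a <ᵇ φ y) ≡ (φ b <ᵇ φ y) × (φ y <ᵇ φ a) ≡ (φ y <ᵇ φ b)
    twins good y (y≤ , o) =
      trans (proj₁ (compare a∈)) (sym (proj₁ (compare b∈))) , trans (proj₂ (compare a∈)) (sym (proj₂ (compare b∈)))
      where
      compare = λ {u} (u∈ : InPair u) →
        pair-compare good u∈ y≤ (proj₁ (other-off-pair (y≤ , o))) (proj₂ (other-off-pair (y≤ , o)))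

    argmin = interval-argmin F a b (ℕ.<⇒≤ a<b)

    c : ℕ
    c = proj₁ argmin

    a≤c : a ≤ c
    a≤c = proj₁ (proj₂ argmin)

    c≤b : c ≤ b
    c≤b = proj₁ (proj₂ (proj₂ argmin))

    c-least : ∀ i → a ≤ i → i ≤ b → ¬ F i < F c
    c-least = proj₂ (proj₂ (proj₂ argmin))

    a-descends : F (suc a) < F a
    a-descends with proj₂ (pair-max a∈)
    ... | inj₁ a≡1+m = ⊥-elim (ℕ.<⇒≱ a<b (subst (b ≤_) (sym a≡1+m) b≤))
    ... | inj₂ 1+a<a = 1+a<a

    b-ascends : F (b ∸ 1) < F b
    b-ascends with proj₁ (pair-max b∈)
    ... | inj₁ b≡0   = ⊥-elim (ℕ.n≮0 (subst (a <ₙ_) b≡0 a<b))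
    ... | inj₂ b-1<b = b-1<b

    a<c : a <ₙ c
    a<c = ℕ.≤∧≢⇒< a≤c λ a≡c → c-least (suc a) (ℕ.n≤1+n a) a<b (subst (λ z → F (suc a) < F z) a≡c a-descends)

    c<b : c <ₙ b
    c<b = ℕ.≤∧≢⇒< c≤b λ c≡b →
      c-least (b ∸ 1) (ℕ.∸-monoˡ-≤ 1 a<b) (ℕ.m∸n≤m b 1) (subst (λ z → F (b ∸ 1) < F z) (sym c≡b) b-ascends)

    o-c : Other c
    o-c = ℕ.≤-trans c≤b b≤ , ℕ.>⇒≢ a<c , ℕ.<⇒≢ c<b

    c-strict : ∀ i → a ≤ i → i ≤ b → i ≢ c → F c < F i
    c-strict i a≤i i≤b i≢c with ℚ.<-cmp (F c) (F i)
    ... | tri< c<i _ _ = c<i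
    ... | tri≈ _ c≈i _ = ⊥-elim ([ proj₁ (other-off-pair o-c) , proj₂ (other-off-pair o-c) ]′
                            (second∈pair (distinct i c (ℕ.≤-trans i≤b b≤) (proj₁ o-c) i≢c (sym c≈i))))
    ... | tri> _ _ i<c = ⊥-elim (c-least i a≤i i≤b i<c)

    c∈crits : c ∈ crits F m
    c∈crits = crit⇒∈crits F m (proj₁ o-c) (strictMin⇒isCritᵇ F m
      (c-strict (c ∸ 1) (ℕ.∸-monoˡ-≤ 1 a<c) (ℕ.≤-trans (ℕ.m∸n≤m c 1) c≤b) (pred≢self a<c))
      (c-strict (suc c) (ℕ.≤-trans a≤c (ℕ.n≤1+n c)) c<b ℕ.1+n≢n))

    Fc<Fj : F c < F j
    Fc<Fj = subst (F c <_) (pair-value a∈) (ℚ.≤-<-trans (ℚ.≮⇒≥ (c-least (suc a) (ℕ.n≤1+n a) a<b)) a-descends)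

    below-pair : ∀ {φ u x} → Good φ → InPair u → Other x → F x < F j → φ x < φ u
    below-pair {φ} {u} {x} good u∈ o-x x<j =
      subst (_< φ u) (sym (proj₁ good x (proj₁ (other-off-pair o-x)))) (proj₁ (sameSide-pair good u∈ x (proj₁ o-x)) x<j)

    above-pair : ∀ {φ u x} → Good φ → InPair u → Other x → F j < F x → φ u < φ x
    above-pair {φ} {u} {x} good u∈ o-x j<x =
      subst (φ u <_) (sym (proj₁ good x (proj₁ (other-off-pair o-x)))) (proj₂ (sameSide-pair good u∈ x (proj₁ o-x)) j<x)
    module CritSplit (pre mid post : List ℕ) (crits≡L : crits F m ≡ pre ++ a ∷ mid ++ b ∷ post)
      (pre<a : All (_<ₙ a) pre) (a<mid<b : All (λ x → a <ₙ x × x <ₙ b) mid) (b<post : All (b <ₙ_) post) where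

      L : List ℕ
      L = pre ++ a ∷ mid ++ b ∷ post

      L-bounded : ∀ {x} → x ∈ L → x ≤ suc m
      L-bounded x∈ = crits-bounded F m (subst (_ ∈_) (sym crits≡L) x∈)

      o-pre : All Other pre
      o-pre = All.tabulate λ {x} x∈ → let x<a = All.lookup pre<a x∈ in
        L-bounded (∈-++⁺ˡ x∈) , ℕ.<⇒≢ x<a , ℕ.<⇒≢ (ℕ.<-trans x<a a<b)

      o-mid : All Other mid
      o-mid = All.tabulate λ {x} x∈ → let (a<x , x<b) = All.lookup a<mid<b x∈ in
        L-bounded (∈-++⁺ʳ pre (there (∈-++⁺ˡ x∈))) , ℕ.>⇒≢ a<x , ℕ.<⇒≢ x<b

      o-post : All Other post
      o-post = All.tabulate λ {x} x∈ → let b<x = All.lookup b<post x∈ in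
        L-bounded (∈-++⁺ʳ pre (there (∈-++⁺ʳ mid (there x∈)))) , ℕ.>⇒≢ (ℕ.<-trans a<b b<x) , ℕ.>⇒≢ b<x

      c∈mid : c ∈ mid
      c∈mid = ∈-between pre<a b<post (subst (c ∈_) crits≡L c∈crits) a<c c<b

      upTree≡ : ∀ {φ} → Good φ → upTree φ m ≡ insertAll φ empty L
      upTree≡ {φ} good = cong (insertAll φ empty) (trans (good-crits good) crits≡L)

      downTree≡ : ∀ {φ} → Good φ → downTree φ m ≡ insertAll (neg φ) empty L
      downTree≡ {φ} good = cong (insertAll (neg φ) empty) (trans (crits-neg φ m) (trans (good-crits good) crits≡L))

      rotation-case : ∀ {φ ψ} → Good φ → Good ψ → (φ b <ᵇ φ a) ≢ (ψ b <ᵇ ψ a) →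
        All (λ x → F x < F j) mid → Rot a b (upTree φ m) (upTree ψ m)
      rotation-case {φ} {ψ} gφ gψ flips below = subst₂ (Rot a b) (sym (upTree≡ gφ)) (sym (upTree≡ gψ))
        (Change.insertAll-rot-adjacent pre mid post o-pre o-mid o-post (twins gφ) mid<a flips)
        where
        module Change = SinglePairChange φ ψ (suc m) a b a≤ b≤ (good-differ-ab gφ gψ)
        mid<a : All (λ x → φ x < φ a) mid
        mid<a = All.tabulate λ x∈ → below-pair gφ a∈ (All.lookup o-mid x∈) (All.lookup below x∈)

      downTree-cong : ∀ {φ ψ} → Good φ → Good ψ → insertAll (neg φ) empty L ≡ insertAll (neg ψ) empty L
      downTree-cong {φ} {ψ} gφ gψ = Change.insertAll-cong-separated pre mid post o-pre o-mid o-post c∈mid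
        (trans (neg-<ᵇ (φ c) (φ a)) (≮⇒<ᵇ≡false (ℚ.<-asym (below-pair gφ a∈ o-c Fc<Fj))))
        where module Change = SinglePairChange (neg φ) (neg ψ) (suc m) a b a≤ b≤ (neg-differ-ab gφ gψ)

      minNode-cong-separated : ∀ {φ ψ k} → Good φ → Good ψ → ψ j ≢ F j → k ∈ mid → F j < F k →
        ∀ t → Subtree t (insertAll (neg φ) empty L) → minNode (neg φ) t ≡ minNode (neg ψ) t
      minNode-cong-separated {φ} {ψ} {k} gφ gψ moved k∈mid j<k t sub with subtree⇒infix sub
      ... | us , vs , D≡ = minNode-cong (neg φ) (neg ψ) t injective agree
        where
        inorder-D : inorder (insertAll (neg φ) empty L) ≡ L
        inorder-D = inorder-insertAll (neg φ) empty L

        bounded : ∀ {y} → y ∈ inorder t → y ≤ suc m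
        bounded y∈ = L-bounded (subst (_ ∈_) inorder-D (subst (_ ∈_) (sym D≡) (∈-++⁺ʳ us (∈-++⁺ˡ y∈))))

        injective : ∀ y y′ → y ∈ inorder t → y′ ∈ inorder t → neg ψ y ≡ neg ψ y′ → y ≡ y′
        injective y y′ y∈ y′∈ e = good-injective gψ moved y y′ (bounded y∈) (bounded y′∈) (ℚ.neg-injective e)

        -- A subtree containing a and b contains k, which beats both; so the minimisers never form the pair.
        agree : ∀ y y′ → Minimiser (neg φ) t y → Minimiser (neg ψ) t y′ →
          (neg φ y′ <ᵇ neg φ y) ≡ (neg ψ y′ <ᵇ neg ψ y)
        agree y y′ (y∈ , least) (y′∈ , _) with samePair? a b y′ y
        ... | no ¬pair = neg-differ-ab gφ gψ y′ y (bounded y′∈) (bounded y∈) ¬pair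
        ... | yes pair = ⊥-elim (least k k∈t (ℚ.neg-antimono-< (above-pair gφ y∈pair (All.lookup o-mid k∈mid) j<k)))
          where
          ends : a ∈ inorder t × b ∈ inorder t
          ends = [ (λ { (refl , refl) → y′∈ , y∈ }) , (λ { (refl , refl) → y∈ , y′∈ }) ]′ pair
          y∈pair : InPair y
          y∈pair = [ (λ { refl → a∈ }) , (λ { refl → b∈ }) ]′ (second∈pair pair)
          k∈t : k ∈ inorder t
          k∈t = sorted-infix-between us (inorder t) vs
                  (subst Sorted D≡ (subst Sorted (sym inorder-D) (subst Sorted crits≡L (crits-sorted F m))))
                  (proj₁ ends) (proj₂ ends)
                  (subst (k ∈_) D≡ (subst (k ∈_) (sym inorder-D) (∈-++⁺ʳ pre (there (∈-++⁺ˡ k∈mid)))))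
                  (proj₁ (All.lookup a<mid<b k∈mid)) (proj₂ (All.lookup a<mid<b k∈mid))

      separated-case : ∀ {φ ψ k} → Good φ → Good ψ → ψ j ≢ F j → k ∈ mid → F j < F k →
        pairing (neg φ) (downTree φ m) ≡ pairing (neg ψ) (downTree ψ m)
      separated-case {φ} {ψ} gφ gψ moved k∈mid j<k = begin
        pairing (neg φ) (downTree φ m) ≡⟨ cong (pairing (neg φ)) (downTree≡ gφ) ⟩
        pairing (neg φ) D              ≡⟨ pairing-cong (neg φ) (neg ψ) D (minNode-cong-separated gφ gψ moved k∈mid j<k) ⟩
        pairing (neg ψ) D              ≡⟨ cong (pairing (neg ψ)) (trans (downTree-cong gφ gψ) (sym (downTree≡ gψ))) ⟩
        pairing (neg ψ) (downTree ψ m) ∎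
        where
        open ≡-Reasoning
        D = insertAll (neg φ) empty L

      interchange : ∀ {φ ψ} → Good φ → Good ψ → ψ j ≢ F j → (φ b <ᵇ φ a) ≢ (ψ b <ᵇ ψ a) →
        RelevantMinInterchange m φ ψ → RelevantMaxInterchange m φ ψ j q
      interchange gφ gψ moved flips relevant with All.all? (λ x → F x <? F j) mid
      ... | yes below = Rot-relabel (samePair-trans ab) (rotation-case gφ gψ flips below)
      ... | no ¬below with find (AllP.¬All⇒Any¬ (λ x → F x <? F j) mid ¬below)
      ...   | k , k∈mid , k≮j = ⊥-elim (relevant (separated-case gφ gψ moved k∈mid j<k))
        where
        o-k = All.lookup o-mid k∈mid
        j<k : F j < F k
        j<k with ℚ.<-cmp (F j) (F k)
        ... | tri< j<k _ _ = j<k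
        ... | tri≈ _ j≈k _ = ⊥-elim (off-pair-distinct (proj₁ o-k) (proj₁ (other-off-pair o-k))
                                       (proj₂ (other-off-pair o-k)) (sym j≈k))
        ... | tri> _ _ k<j = ⊥-elim (k≮j k<j)

    interchange : ∀ {φ ψ} → Good φ → Good ψ → ψ j ≢ F j → (φ b <ᵇ φ a) ≢ (ψ b <ᵇ ψ a) →
      RelevantMinInterchange m φ ψ → RelevantMaxInterchange m φ ψ j q
    interchange with sorted-split (crits-sorted F m)
                       (crit⇒∈crits F m a≤ (isMax⇒isCritᵇ F m (pair-max a∈)))
                       (crit⇒∈crits F m b≤ (isMax⇒isCritᵇ F m (pair-max b∈))) a<b
    ... | pre , mid , post , crits≡L , pre<a , a<mid<b , b<post =
      CritSplit.interchange pre mid post crits≡L pre<a a<mid<b b<post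

  relevance : ∀ ε → 0ℚ < ε → ε < ε₀ →
    RelevantMinInterchange m (perturb F j (- ε)) (perturb F j ε) →
    RelevantMaxInterchange m (perturb F j (- ε)) (perturb F j ε) j q
  relevance ε 0<ε ε<ε₀ = by-order (ℕ.<-cmp j q)
    where
    good-down = good-perturb (- ε) (sameSide-down 0<ε ε<ε₀)
    good-up   = good-perturb ε (sameSide-up 0<ε ε<ε₀)

    down : perturb F j (- ε) j < F j
    down = subst (_< F j) (sym (perturb-at F j (- ε))) (p-q<p (F j) 0<ε)

    up : F j < perturb F j ε j
    up = subst (F j <_) (sym (perturb-at F j ε)) (p<p+q (F j) 0<ε)

    moved : perturb F j ε j ≢ F j
    moved e = ℚ.<-irrefl (sym e) up

    by-order : Tri (j <ₙ q) (j ≡ q) (q <ₙ j) →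
      RelevantMinInterchange m (perturb F j (- ε)) (perturb F j ε) →
      RelevantMaxInterchange m (perturb F j (- ε)) (perturb F j ε) j q
    by-order (tri< j<q _ _) = OrderedPair.interchange j q j<q (inj₁ (refl , refl)) good-down good-up moved
                                (pair-flips good-down good-up (inj₁ (refl , refl)) down up)
    by-order (tri≈ _ j≡q _) = ⊥-elim (j≢q j≡q)
    by-order (tri> _ _ q<j) = OrderedPair.interchange q j q<j (inj₂ (refl , refl)) good-down good-up moved
                                (pair-flips good-down good-up (inj₂ (refl , refl)) down up)

lemma4p4 : (m : ℕ) (F : ℕ → ℚ) (j q : ℕ) →
    j ≤ suc m → q ≤ suc m → j ≢ q →
    IsMax F m j → IsMax F m q → F j ≡ F q →
    (∀ x y → x ≤ suc m → y ≤ suc m → x ≢ y → F x ≡ F y →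
      ((x ≡ j) × (y ≡ q)) ⊎ ((x ≡ q) × (y ≡ j))) →
    ∃[ ε₀ ] ((0ℚ < ε₀) × (∀ ε → 0ℚ < ε → ε < ε₀ →
      RelevantMinInterchange m (perturb F j (- ε)) (perturb F j ε) →
      RelevantMaxInterchange m (perturb F j (- ε)) (perturb F j ε) j q))
lemma4p4 m F j q j≤ q≤ j≢q max-j max-q Fj≡Fq distinct = ε₀ , 0<ε₀ , relevance
  where open TwoEqualMaxima m F j q j≤ q≤ j≢q max-j max-q Fj≡Fq distinct
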